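{- Let $\alpha\in\mathcal{CO}_\sigma$ and $\eta\in\mathcal{PCO}_\sigma$. If $\alpha\vdash\eta$, then $\vdash\alpha\supset\eta$. If furthermore $\eta\in\mathcal{CO}_\sigma$, then $\vdash\Pr(\alpha)=\epsilon\to\Pr(\eta)\geq\epsilon$ for every $\epsilon\in[0,1]\cap\mathbb Q$.
   Context: Signature $\sigma=(\mathrm{Dom},\mathrm{Ran})$: a finite nonempty set $\mathrm{Dom}$ of variables with a fixed ordering, and finite nonempty value sets $\mathrm{Ran}(X)$; $\mathbf W_V$ lists $\mathrm{Dom}\setminus\{V\}$ in order, $\mathbf W_{XY}$ lists $\mathrm{Dom}\setminus\{X,Y\}$. $\mathbf X=\mathbf x$ abbreviates $X_1=x_1\wedge\dots\wedge X_n=x_n$; it is consistent unless some variable is assigned two distinct values. Language $\mathcal{CO}_\sigma$: $\alpha::= Y=y\mid Y\neq y\mid\alpha\wedge\alpha\mid\alpha\supset\alpha\mid \mathbf X=\mathbf x\,\Box\!\!\to\alpha$. Abbreviations: $\top:=X=x\,\Box\!\!\to X=x$, $\bot:=X=x\,\Box\!\!\to X\neq x$ (fixed $X,x$), $\neg\alpha:=\alpha\supset\bot$, $\alpha\vee\beta:=\neg(\neg\alpha\wedge\neg\beta)$, $\alpha\equiv\beta:=(\alpha\supset\beta)\wedge(\beta\supset\alpha)$. Language $\mathcal{PCO}_\sigma$: $\varphi::=\eta\mid\varphi\wedge\varphi\mid\varphi\sqcup\varphi\mid\alpha\supset\varphi\mid\mathbf X=\mathbf x\,\Box\!\!\to\varphi$,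 $\alpha\in\mathcal{CO}$, $\eta$ a literal $Y=y$, $Y\neq y$ or a probabilistic atom $\Pr(\alpha)\geq\epsilon$, $\Pr(\alpha)>\epsilon$, $\Pr(\alpha)\geq\Pr(\beta)$, $\Pr(\alpha)>\Pr(\beta)$ ($\epsilon\in[0,1]\cap\mathbb Q$). Abbreviations: $\Pr(\alpha)\leq\epsilon:=\Pr(\neg\alpha)\geq1-\epsilon$; $\Pr(\alpha)<\epsilon:=\Pr(\neg\alpha)>1-\epsilon$; $\Pr(\alpha)=\epsilon:=\Pr(\alpha)\geq\epsilon\wedge\Pr(\alpha)\leq\epsilon$; $\Pr(\alpha)\neq\epsilon:=\Pr(\alpha)>\epsilon\sqcup\Pr(\alpha)<\epsilon$. The operation $\varphi\mapsto\varphi^C$: $(\Pr(\alpha)\geq\epsilon)^C=\Pr(\alpha)<\epsilon$ and vice versa; $(\Pr(\alpha)>\epsilon)^C=\Pr(\alpha)\leq\epsilon$ and vice versa; $(\Pr(\alpha)=\epsilon)^C=\Pr(\alpha)\neq\epsilon$ and vice versa; $(\Pr(\alpha)\geq\Pr(\beta))^C=\Pr(\beta)>\Pr(\alpha)$ and vice versa; $\bot^C=\top$ and vice versa; $(X=x)^C=\Pr(X=x)<1$; $(X\neq x)^C=\Pr(X\neq x)<1$; $(\psi\wedge\chi)^C=\psi^C\sqcup\chi^C$; $(\psi\sqcup\chi)^C=\psi^C\wedge\chi^C$; $(\alpha\supset\chi)^C=\Pr(\alpha)>0\wedge\alpha\supset\chi^C$; $(\mathbf X=\mathbf x\,\Box\!\!\to\chi)^C=\mathbf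 X=\mathbf x\,\Box\!\!\to\chi^C$. $\psi\to\chi:=\psi^C\sqcup\chi$, $\psi\leftrightarrow\chi:=(\psi\to\chi)\wedge(\chi\to\psi)$; $\mathbf Y\neq\mathbf y:=Y_1\neq y_1\sqcup\dots\sqcup Y_n\neq y_n$; $\bigvee,\bigsqcup,\bigwedge$ iterate $\vee,\sqcup,\wedge$. Auxiliary formulas: $\varphi_{DC(X,Y)}:=\bigvee_{x\neq x',\,y\neq y',\,\mathbf w\in\mathrm{Ran}(\mathbf W_{XY})}[((\mathbf W_{XY}=\mathbf w\wedge X=x)\Box\!\!\to Y=y)\wedge((\mathbf W_{XY}=\mathbf w\wedge X=x')\Box\!\!\to Y=y')]$; $\varphi_{End(Y)}:=\bigsqcup_{X\in\mathbf W_Y}\varphi_{DC(X,Y)}$; $X\leadsto Y:=\bigvee_{\mathbf Z\subseteq\mathrm{Dom}\setminus\{X\},\,\mathbf z,\,x\neq x',\,y\neq y'}[((\mathbf Z=\mathbf z\wedge X=x)\Box\!\!\to Y=y)\wedge((\mathbf Z=\mathbf z\wedge X=x')\Box\!\!\to Y=y')]$. Deduction system ($\alpha,\beta$ in $\mathcal{CO}$; $\psi,\chi,\varphi,\theta$ in $\mathcal{PCO}$; $\delta,\epsilon\in[0,1]\cap\mathbb Q$). Axioms: T1: substitution instances of classical tautologies in $\wedge,\sqcup,\to,{}^C,\top,\bot$. T2: $\mathcal{CO}$ instances of classical tautologies in $\wedge,\vee,\supset,\neg,\top,\bot$. P1: $\alpha\leftrightarrow\Pr(\alpha)=1$. P2: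 $\Pr(\alpha)\geq0$. P3: $(\Pr(\alpha)=\delta\wedge\Pr(\beta)=\epsilon\wedge\Pr(\alpha\wedge\beta)=0)\to\Pr(\alpha\vee\beta)=\delta+\epsilon$ ($\delta+\epsilon\leq1$). P3b: $\Pr(\alpha)\geq\epsilon\wedge\Pr(\alpha\wedge\beta)=0\to\Pr(\beta)\leq1-\epsilon$. P4: $\Pr(\alpha)\leq\epsilon\to\Pr(\alpha)<\delta$ ($\delta>\epsilon$). P5: $\Pr(\alpha)<\epsilon\to\Pr(\alpha)\leq\epsilon$. P6: $\Pr(\alpha\equiv\beta)=1\to(\Pr(\alpha)=\epsilon\to\Pr(\beta)=\epsilon)$. P6b: $\Pr(\alpha\supset\beta)=1\to(\Pr(\alpha)=\epsilon\to\Pr(\beta)\geq\epsilon)$. CP1: $(\Pr(\alpha)=\delta\wedge\Pr(\beta)=\epsilon)\to\Pr(\alpha)\geq\Pr(\beta)$ ($\delta\geq\epsilon$). CP2: same with $>$ ($\delta>\epsilon$). O1: $\Pr(\alpha)=0\to(\alpha\supset\psi)$. O1b: $(\alpha\supset\bot)\to\Pr(\alpha)=0$. O2: $(\Pr(\alpha)=\delta\wedge\Pr(\alpha\wedge\beta)=\epsilon)\to(\alpha\supset\Pr(\beta)=\frac{\epsilon}{\delta})$ ($\delta\neq0$). O3: $(\alpha\supset\Pr(\beta)=\epsilon)\to(\Pr(\alpha)=\delta\leftrightarrow\Pr(\alpha\wedge\beta)=\epsilon\cdot\delta)$ ($\epsilon\neq0$). O4: $(\alpha\supset\psi)\to(\alpha\to\psi)$.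 O5$_\wedge$: $\alpha\supset(\psi\wedge\chi)\leftrightarrow(\alpha\supset\psi)\wedge(\alpha\supset\chi)$. O5$_\sqcup$: same with $\sqcup$. O5$_\supset$: $\alpha\supset(\beta\supset\chi)\leftrightarrow(\alpha\wedge\beta)\supset\chi$. A1: $\mathbf Y=\mathbf y\to\mathbf Y\neq\mathbf y'$ ($\mathbf y\neq\mathbf y'$). A2: $X\neq x\leftrightarrow(X=x\supset\bot)$. A3: $\bigvee_{\mathbf y\in\mathrm{Ran}(\mathbf Y)}\mathbf Y=\mathbf y$. C1: $(\mathbf X=\mathbf x\Box\!\!\to(\psi\wedge\chi))\leftrightarrow((\mathbf X=\mathbf x\Box\!\!\to\psi)\wedge(\mathbf X=\mathbf x\Box\!\!\to\chi))$. C2: same with $\sqcup$. C3: $(\mathbf X=\mathbf x\Box\!\!\to(\alpha\supset\chi))\leftrightarrow((\mathbf X=\mathbf x\Box\!\!\to\alpha)\supset(\mathbf X=\mathbf x\Box\!\!\to\chi))$. C4: $(\mathbf X=\mathbf x\Box\!\!\to(\mathbf Y=\mathbf y\Box\!\!\to\chi))\to((\mathbf X'=\mathbf x'\wedge\mathbf Y=\mathbf y)\Box\!\!\to\chi)$, $\mathbf X'=\mathbf X\setminus\mathbf Y$, $\mathbf x'$ corresponding values, $\mathbf X=\mathbf x$ consistent. C4b: $((\mathbf X=\mathbf x\wedge\mathbf Y=\mathbf y)\Box\!\!\to\chi)\to(\mathbf X=\mathbf x\Box\!\!\to(\mathbf Y=\mathbf y\Box\!\!\to\chi))$. C5: $(\mathbf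 X=\mathbf x\Box\!\!\to\bot)\to\psi$ ($\mathbf X=\mathbf x$ consistent). C6: $(\mathbf X=\mathbf x\wedge Y=y)\Box\!\!\to Y=y$. C7: $(\mathbf X=\mathbf x\wedge\gamma)\to(\mathbf X=\mathbf x\Box\!\!\to\gamma)$, $\gamma\in\mathcal{PCO}$ without $\Box\!\!\to$. C8: $(\mathbf X=\mathbf x\Box\!\!\to\Pr(\alpha)\rhd\epsilon)\leftrightarrow\Pr(\mathbf X=\mathbf x\Box\!\!\to\alpha)\rhd\epsilon$ ($\rhd\in\{\geq,>\}$). C8b: $(\mathbf X=\mathbf x\Box\!\!\to\Pr(\alpha)\rhd\Pr(\beta))\leftrightarrow\Pr(\mathbf X=\mathbf x\Box\!\!\to\alpha)\rhd\Pr(\mathbf X=\mathbf x\Box\!\!\to\beta)$. C9: $\varphi_{End(Y)}\to(\mathbf W_Y=\mathbf w\Box\!\!\to\bigsqcup_{y}Y=y)$. C10: $(\varphi_{End(Y)})^C\to(Y=y\supset(\mathbf W_Y=\mathbf w\Box\!\!\to Y=y))$. C11: $(X_1\leadsto X_2\wedge\dots\wedge X_{n-1}\leadsto X_n)\to(X_n\leadsto X_1)^C$ ($n>1$). Rules: MP (from $\psi$, $\psi\to\chi$ infer $\chi$); Rep (from $\vdash\varphi$, $\vdash\theta\leftrightarrow\theta'$ infer $\vdash\varphi[\theta'/\theta]$ if well-formed); $\bot^\omega$ (from $\psi\to\Pr(\alpha)\neq\epsilon$ for all $\epsilon\in[0,1]\cap\mathbb Q$ infer $\psi\to\bot$); Mon$_\supset$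 (from $\vdash\psi\to\chi$ infer $\vdash(\alpha\supset\psi)\to(\alpha\supset\chi)$); $\to$to$\supset$ (from $\vdash\alpha\to\psi$ infer $\vdash\alpha\supset\psi$); $\supset^\omega$ (from $\psi\to(\Pr(\alpha\wedge\beta)=\delta\epsilon\leftrightarrow\Pr(\alpha)=\epsilon)$ for all $\epsilon\in(0,1]\cap\mathbb Q$ infer $\psi\to(\alpha\supset\Pr(\beta)=\delta)$); Mon$_{\Box\!\to}$ (from $\vdash\psi\to\chi$ infer $\vdash(\mathbf X=\mathbf x\Box\!\!\to\psi)\to(\mathbf X=\mathbf x\Box\!\!\to\chi)$). $\Gamma\vdash\varphi$ iff there is a sequence indexed by ordinals $\leq\kappa$ (countable) ending in $\varphi$, each term an axiom, in $\Gamma$, or obtained from earlier terms by a rule, where Rep, Mon$_\supset$, Mon$_{\Box\!\to}$, $\to$to$\supset$ apply only to theorems (formulas derivable from $\emptyset$). -}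

module Defs where

open import Data.Nat using (ℕ; zero; suc)
open import Data.Fin using (Fin; zero; suc; _≟_)
open import Data.Bool using (Bool; true; false; _∧_; _∨_; not)
open import Data.Product using (Σ; _×_; _,_; proj₁; proj₂)
open import Data.Empty using (⊥)
open import Data.List using (List; []; _∷_; map; concatMap; filter; allFin; _++_)
open import Data.List.NonEmpty as L⁺ using (List⁺; toList)
open import Data.List.Relation.Unary.All using (All; []; _∷_)
open import Data.List.Relation.Unary.Any using (any?)
open import Data.List.Membership.Propositional using (_∈_)
open import Data.Rational using (ℚ; 0ℚ; 1ℚ; _≤_; _<_; _+_; _*_; _-_; -_)
open import Data.Rational.Properties using (≤-refl; ≤-trans; +-monoˡ-≤; +-monoʳ-≤; +-inverseʳ; +-identityʳ; neg-antimono-≤; ≤-reflexive)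
open import Relation.Nullary using (¬_; ¬?)
open import Relation.Binary.PropositionalEquality using (_≡_; _≢_; refl; sym)

-- Signatures.  Dom = Fin (suc d) (nonempty, ordered by the order of Fin);
-- Ran(X) = Fin (suc (r X)) (finite, nonempty).

record Sig : Set where
  field
    d : ℕ
    r : Fin (suc d) → ℕ

-- Rational numbers in [0,1] (proofs irrelevant, so equality = equality of values)

record Prob : Set where
  constructor prob
  field
    val : ℚ
    .lo : 0ℚ ≤ val
    .hi : val ≤ 1ℚ

open Prob public

zeroP : Prob
zeroP = prob 0ℚ ≤-refl (Data.Rational.Properties.nonNegative⁻¹ 1ℚ)
  where import Data.Rational.Properties

oneP : Prob
oneP = prob 1ℚ (Data.Rational.Properties.nonNegative⁻¹ 1ℚ) ≤-refl
  where import Data.Rational.Properties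

compl : Prob → Prob
compl (prob e l h) = prob (1ℚ - e) (lo' h) (hi' l)
  where
  lo' : ∀ {e} → e ≤ 1ℚ → 0ℚ ≤ 1ℚ - e
  lo' {e} h = ≤-trans (≤-reflexive (sym (+-inverseʳ e))) (+-monoˡ-≤ (- e) h)
  hi' : ∀ {e} → 0ℚ ≤ e → 1ℚ - e ≤ 1ℚ
  hi' l = ≤-trans (+-monoʳ-≤ 1ℚ (neg-antimono-≤ l)) (≤-reflexive (+-identityʳ 1ℚ))

module _ {σ : Sig} where

  Var : Set
  Var = Fin (suc (Sig.d σ))

  Val : Var → Set
  Val X = Fin (suc (Sig.r σ X))

  allVals : (X : Var) → List (Val X)
  allVals X = allFin (suc (Sig.r σ X))

  Lit : Set
  Lit = Σ Var Val

  -- antecedent X = x of a counterfactual: a nonempty list of literals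
  -- (possibly inconsistent)
  Asg : Set
  Asg = List⁺ Lit

  Consistent : List Lit → Set
  Consistent a = ∀ {X : Var} {x x' : Val X} → (X , x) ∈ a → (X , x') ∈ a → x ≡ x'

  infixr 6 _∧C_
  infixr 5 _⊃C_
  infixr 7 _□→C_

  data CO : Set where
    eqC  : (Y : Var) → Val Y → CO
    neqC : (Y : Var) → Val Y → CO
    _∧C_ : CO → CO → CO
    _⊃C_ : CO → CO → CO
    _□→C_ : Asg → CO → CO

  X₀ : Var
  X₀ = zero

  x₀ : Val X₀
  x₀ = zero

  ⊤C : CO
  ⊤C = ((X₀ , x₀) L⁺.∷ []) □→C eqC X₀ x₀

  ⊥C : CO
  ⊥C = ((X₀ , x₀) L⁺.∷ []) □→C neqC X₀ x₀

  ¬C : CO → CO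
  ¬C a = a ⊃C ⊥C

  infixr 5 _∨C_
  _∨C_ : CO → CO → CO
  a ∨C b = ¬C (¬C a ∧C ¬C b)

  _≡C_ : CO → CO → CO
  a ≡C b = (a ⊃C b) ∧C (b ⊃C a)

  ⋁C : List CO → CO
  ⋁C [] = ⊥C
  ⋁C (a ∷ []) = a
  ⋁C (a ∷ as) = a ∨C ⋁C as

  ⋀C : List CO → CO
  ⋀C [] = ⊤C
  ⋀C (a ∷ []) = a
  ⋀C (a ∷ as) = a ∧C ⋀C as

  data Cmp : Set where
    ge gt : Cmp

  infixr 6 _∧P_
  infixr 4 _⊔_
  infixr 5 _⊃P_
  infixr 7 _□→P_

  data PCO : Set where
    eqP  : (Y : Var) → Val Y → PCO
    neqP : (Y : Var) → Val Y → PCO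
    pr   : Cmp → CO → Prob → PCO
    prp  : Cmp → CO → CO → PCO
    _∧P_ : PCO → PCO → PCO
    _⊔_  : PCO → PCO → PCO
    _⊃P_ : CO → PCO → PCO
    _□→P_ : Asg → PCO → PCO

  ↑ : CO → PCO
  ↑ (eqC Y y) = eqP Y y
  ↑ (neqC Y y) = neqP Y y
  ↑ (a ∧C b) = ↑ a ∧P ↑ b
  ↑ (a ⊃C b) = a ⊃P ↑ b
  ↑ (X □→C a) = X □→P ↑ a

  ⊤P ⊥P : PCO
  ⊤P = ↑ ⊤C
  ⊥P = ↑ ⊥C

  PrGe PrGt PrLe PrLt PrEq PrNe : CO → Prob → PCO
  PrGe a e = pr ge a e
  PrGt a e = pr gt a e
  PrLe a e = pr ge (¬C a) (compl e)
  PrLt a e = pr gt (¬C a) (compl e)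
  PrEq a e = PrGe a e ∧P PrLe a e
  PrNe a e = PrGt a e ⊔ PrLt a e

  -- the operation φ ↦ φᶜ
  -- (clauses are tried in order: the ⊤/⊥ clauses and the "vice versa"
  --  clauses for Pr(α) ≤ ε, Pr(α) < ε take priority)
  infix 9 _ᶜ
  _ᶜ : PCO → PCO
  eqP Y y ᶜ = PrLt (eqC Y y) oneP
  neqP Y y ᶜ = PrLt (neqC Y y) oneP
  pr ge (a ⊃C (((zero , zero) L⁺.∷ []) □→C neqC zero zero)) e ᶜ = PrGt a (compl e)
  pr ge a e ᶜ = PrLt a e
  pr gt (a ⊃C (((zero , zero) L⁺.∷ []) □→C neqC zero zero)) e ᶜ = PrGe a (compl e)
  pr gt a e ᶜ = PrLe a e
  prp ge a b ᶜ = prp gt b a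
  prp gt a b ᶜ = prp ge b a
  (φ ∧P ψ) ᶜ = φ ᶜ ⊔ ψ ᶜ
  (φ ⊔ ψ) ᶜ = φ ᶜ ∧P ψ ᶜ
  (a ⊃P χ) ᶜ = PrGt a zeroP ∧P (a ⊃P χ ᶜ)
  (((zero , zero) L⁺.∷ []) □→P eqP zero zero) ᶜ = ⊥P
  (((zero , zero) L⁺.∷ []) □→P neqP zero zero) ᶜ = ⊤P
  (X □→P χ) ᶜ = X □→P χ ᶜ

  infixr 3 _⇒_
  infix 3 _⇔_
  _⇒_ : PCO → PCO → PCO
  ψ ⇒ χ = ψ ᶜ ⊔ χ

  _⇔_ : PCO → PCO → PCO
  ψ ⇔ χ = (ψ ⇒ χ) ∧P (χ ⇒ ψ)

  ⨆ : List PCO → PCO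
  ⨆ [] = ⊥P
  ⨆ (a ∷ []) = a
  ⨆ (a ∷ as) = a ⊔ ⨆ as

  ⋀P : List PCO → PCO
  ⋀P [] = ⊤P
  ⋀P (a ∷ []) = a
  ⋀P (a ∷ as) = a ∧P ⋀P as

  -- counterfactual with a possibly empty antecedent (empty = no intervention)
  cfL : List Lit → PCO → PCO
  cfL [] φ = φ
  cfL (l ∷ ls) φ = (l L⁺.∷ ls) □→P φ

  Tup : List Var → Set
  Tup Ws = All Val Ws

  toLits : {Ws : List Var} → Tup Ws → List Lit
  toLits {[]} [] = []
  toLits {W ∷ Ws} (w ∷ ws) = (W , w) ∷ toLits ws

  allTups : (Ws : List Var) → List (Tup Ws)
  allTups [] = [] ∷ []
  allTups (W ∷ Ws) = concatMap (λ w → map (w ∷_) (allTups Ws)) (allVals W)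

  eqLits : List Lit → CO
  eqLits ls = ⋀C (map (λ l → eqC (proj₁ l) (proj₂ l)) ls)

  neqLits : List Lit → PCO
  neqLits ls = ⨆ (map (λ l → neqP (proj₁ l) (proj₂ l)) ls)

  distinctPairs : (X : Var) → List (Val X × Val X)
  distinctPairs X =
    filter (λ p → ¬? (proj₁ p ≟ proj₂ p))
      (concatMap (λ x → map (λ x' → (x , x')) (allVals X)) (allVals X))

  Dom : List Var
  Dom = allFin (suc (Sig.d σ))

  W₁ : Var → List Var
  W₁ V = filter (λ Z → ¬? (Z ≟ V)) Dom

  W₂ : Var → Var → List Var
  W₂ X Y = filter (λ Z → ¬? (Z ≟ Y)) (W₁ X)

  -- ordered sublists (= subsets of a duplicate-free list)
  sublists : List Var → List (List Var)
  sublists [] = [] ∷ []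
  sublists (v ∷ vs) = map (v ∷_) (sublists vs) ++ sublists vs

  dcPair : List Lit → (X : Var) → Val X × Val X → (Y : Var) → Val Y × Val Y → CO
  dcPair zs X (x , x') Y (y , y') =
    ((zs L⁺.∷ʳ (X , x)) □→C eqC Y y) ∧C ((zs L⁺.∷ʳ (X , x')) □→C eqC Y y')

  dcAll : List Lit → (X : Var) → (Y : Var) → List CO
  dcAll zs X Y =
    concatMap (λ xx → map (λ yy → dcPair zs X xx Y yy) (distinctPairs Y)) (distinctPairs X)

  φDC : Var → Var → CO
  φDC X Y = ⋁C (concatMap (λ w → dcAll (toLits w) X Y) (allTups (W₂ X Y)))

  φEnd : Var → PCO
  φEnd Y = ⨆ (map (λ X → ↑ (φDC X Y)) (W₁ Y))

  infix 8 _⇝_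
  _⇝_ : Var → Var → CO
  X ⇝ Y = ⋁C (concatMap (λ Zs → concatMap (λ z → dcAll (toLits z) X Y) (allTups Zs))
                         (sublists (W₁ X)))

  links : Var → List Var → List PCO
  links X [] = []
  links X (Y ∷ Ys) = ↑ (X ⇝ Y) ∷ links Y Ys

  lastOf : Var → List Var → Var
  lastOf X [] = X
  lastOf X (Y ∷ Ys) = lastOf Y Ys

  removeVars : List Lit → List Var → List Lit
  removeVars ls vs = filter (λ l → ¬? (any? (λ v → proj₁ l ≟ v) vs)) ls

  data NoCfC : CO → Set where
    eqC  : ∀ {Y y} → NoCfC (eqC Y y)
    neqC : ∀ {Y y} → NoCfC (neqC Y y)
    _∧C_ : ∀ {a b} → NoCfC a → NoCfC b → NoCfC (a ∧C b)
    _⊃C_ : ∀ {a b} → NoCfC a → NoCfC b → NoCfC (a ⊃C b)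

  data NoCf : PCO → Set where
    eqP  : ∀ {Y y} → NoCf (eqP Y y)
    neqP : ∀ {Y y} → NoCf (neqP Y y)
    pr   : ∀ {c a e} → NoCfC a → NoCf (pr c a e)
    prp  : ∀ {c a b} → NoCfC a → NoCfC b → NoCf (prp c a b)
    _∧P_ : ∀ {φ ψ} → NoCf φ → NoCf ψ → NoCf (φ ∧P ψ)
    _⊔_  : ∀ {φ ψ} → NoCf φ → NoCf ψ → NoCf (φ ⊔ ψ)
    _⊃P_ : ∀ {a φ} → NoCfC a → NoCf φ → NoCf (a ⊃P φ)

  data PF : Set where
    pv : ℕ → PF
    p∧ p⊔ p→ : PF → PF → PF
    pC : PF → PF
    p⊤ p⊥ : PF

  evalPF : (ℕ → Bool) → PF → Bool
  evalPF v (pv i) = v i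
  evalPF v (p∧ p q) = evalPF v p ∧ evalPF v q
  evalPF v (p⊔ p q) = evalPF v p ∨ evalPF v q
  evalPF v (p→ p q) = not (evalPF v p) ∨ evalPF v q
  evalPF v (pC p) = not (evalPF v p)
  evalPF v p⊤ = true
  evalPF v p⊥ = false

  instPF : (ℕ → PCO) → PF → PCO
  instPF s (pv i) = s i
  instPF s (p∧ p q) = instPF s p ∧P instPF s q
  instPF s (p⊔ p q) = instPF s p ⊔ instPF s q
  instPF s (p→ p q) = instPF s p ⇒ instPF s q
  instPF s (pC p) = instPF s p ᶜ
  instPF s p⊤ = ⊤P
  instPF s p⊥ = ⊥P

  data CF : Set where
    cv : ℕ → CF
    c∧ c∨ c⊃ : CF → CF → CF
    c¬ : CF → CF
    c⊤ c⊥ : CF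

  evalCF : (ℕ → Bool) → CF → Bool
  evalCF v (cv i) = v i
  evalCF v (c∧ p q) = evalCF v p ∧ evalCF v q
  evalCF v (c∨ p q) = evalCF v p ∨ evalCF v q
  evalCF v (c⊃ p q) = not (evalCF v p) ∨ evalCF v q
  evalCF v (c¬ p) = not (evalCF v p)
  evalCF v c⊤ = true
  evalCF v c⊥ = false

  instCF : (ℕ → CO) → CF → CO
  instCF s (cv i) = s i
  instCF s (c∧ p q) = instCF s p ∧C instCF s q
  instCF s (c∨ p q) = instCF s p ∨C instCF s q
  instCF s (c⊃ p q) = instCF s p ⊃C instCF s q
  instCF s (c¬ p) = ¬C (instCF s p)
  instCF s c⊤ = ⊤C
  instCF s c⊥ = ⊥C

  data Ax : PCO → Set where
    T1 : (p : PF) (s : ℕ → PCO) → (∀ v → evalPF v p ≡ true) → Ax (instPF s p)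
    T2 : (p : CF) (s : ℕ → CO) → (∀ v → evalCF v p ≡ true) → Ax (↑ (instCF s p))
    P1 : ∀ a → Ax (↑ a ⇔ PrEq a oneP)
    P2 : ∀ a → Ax (PrGe a zeroP)
    P3 : ∀ a b (δ ε γ : Prob) → val γ ≡ val δ + val ε →
         Ax ((PrEq a δ ∧P PrEq b ε ∧P PrEq (a ∧C b) zeroP) ⇒ PrEq (a ∨C b) γ)
    P3b : ∀ a b ε → Ax ((PrGe a ε ∧P PrEq (a ∧C b) zeroP) ⇒ PrLe b (compl ε))
    P4 : ∀ a (δ ε : Prob) → val ε < val δ → Ax (PrLe a ε ⇒ PrLt a δ)
    P5 : ∀ a ε → Ax (PrLt a ε ⇒ PrLe a ε)
    P6 : ∀ a b ε → Ax (PrEq (a ≡C b) oneP ⇒ (PrEq a ε ⇒ PrEq b ε))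
    P6b : ∀ a b ε → Ax (PrEq (a ⊃C b) oneP ⇒ (PrEq a ε ⇒ PrGe b ε))
    CP1 : ∀ a b (δ ε : Prob) → val ε ≤ val δ → Ax ((PrEq a δ ∧P PrEq b ε) ⇒ prp ge a b)
    CP2 : ∀ a b (δ ε : Prob) → val ε < val δ → Ax ((PrEq a δ ∧P PrEq b ε) ⇒ prp gt a b)
    O1 : ∀ a ψ → Ax (PrEq a zeroP ⇒ (a ⊃P ψ))
    O1b : ∀ a → Ax ((a ⊃P ⊥P) ⇒ PrEq a zeroP)
    -- γ = ε / δ
    O2 : ∀ a b (δ ε γ : Prob) → val δ ≢ 0ℚ → val γ * val δ ≡ val ε →
         Ax ((PrEq a δ ∧P PrEq (a ∧C b) ε) ⇒ (a ⊃P PrEq b γ))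
    O3 : ∀ a b (ε δ γ : Prob) → val ε ≢ 0ℚ → val γ ≡ val ε * val δ →
         Ax ((a ⊃P PrEq b ε) ⇒ (PrEq a δ ⇔ PrEq (a ∧C b) γ))
    O4 : ∀ a ψ → Ax ((a ⊃P ψ) ⇒ (↑ a ⇒ ψ))
    O5∧ : ∀ a ψ χ → Ax ((a ⊃P (ψ ∧P χ)) ⇔ ((a ⊃P ψ) ∧P (a ⊃P χ)))
    O5⊔ : ∀ a ψ χ → Ax ((a ⊃P (ψ ⊔ χ)) ⇔ ((a ⊃P ψ) ⊔ (a ⊃P χ)))
    O5⊃ : ∀ a b χ → Ax ((a ⊃P (b ⊃P χ)) ⇔ ((a ∧C b) ⊃P χ))
    A1 : (Ys : List Var) (y y' : Tup Ys) → y ≢ y' → Ax (↑ (eqLits (toLits y)) ⇒ neqLits (toLits y'))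
    A2 : ∀ X x → Ax (neqP X x ⇔ (eqC X x ⊃P ⊥P))
    A3 : (Ys : List Var) → Ax (↑ (⋁C (map (λ y → eqLits (toLits y)) (allTups Ys))))
    C1 : ∀ (X : Asg) ψ χ → Ax ((X □→P (ψ ∧P χ)) ⇔ ((X □→P ψ) ∧P (X □→P χ)))
    C2 : ∀ (X : Asg) ψ χ → Ax ((X □→P (ψ ⊔ χ)) ⇔ ((X □→P ψ) ⊔ (X □→P χ)))
    C3 : ∀ (X : Asg) a χ → Ax ((X □→P (a ⊃P χ)) ⇔ ((X □→C a) ⊃P (X □→P χ)))
    C4 : ∀ (X Y : Asg) χ → Consistent (toList X) →
         Ax ((X □→P (Y □→P χ)) ⇒
             ((removeVars (toList X) (map proj₁ (toList Y)) L⁺.++⁺ Y) □→P χ))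
    C4b : ∀ (X Y : Asg) χ → Ax (((X L⁺.⁺++⁺ Y) □→P χ) ⇒ (X □→P (Y □→P χ)))
    C5 : ∀ (X : Asg) ψ → Consistent (toList X) → Ax ((X □→P ⊥P) ⇒ ψ)
    -- 𝐗 here may be empty
    C6 : ∀ (xs : List Lit) Y y → Ax ((xs L⁺.∷ʳ (Y , y)) □→P eqP Y y)
    C7 : ∀ (X : Asg) γ → NoCf γ → Ax ((↑ (eqLits (toList X)) ∧P γ) ⇒ (X □→P γ))
    C8 : ∀ (X : Asg) c a e → Ax ((X □→P pr c a e) ⇔ pr c (X □→C a) e)
    C8b : ∀ (X : Asg) c a b → Ax ((X □→P prp c a b) ⇔ prp c (X □→C a) (X □→C b))
    C9 : ∀ Y (w : Tup (W₁ Y)) →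
         Ax (φEnd Y ⇒ cfL (toLits w) (⨆ (map (eqP Y) (allVals Y))))
    C10 : ∀ Y y (w : Tup (W₁ Y)) →
          Ax ((φEnd Y) ᶜ ⇒ (eqC Y y ⊃P cfL (toLits w) (eqP Y y)))
    C11 : ∀ (X₁ X₂ : Var) (Xs : List Var) →
          Ax (⋀P (links X₁ (X₂ ∷ Xs)) ⇒ (↑ (lastOf X₂ Xs ⇝ X₁)) ᶜ)

  -- Replacement φ[θ'/θ]: some (possibly none, possibly all) occurrences of θ
  -- replaced by θ'; inside CO positions only when θ, θ' are both CO formulas.

  data ReplC (b b' : CO) : CO → CO → Set where
    here : ReplC b b' b b'
    same : ∀ {a} → ReplC b b' a a
    _∧C_ : ∀ {a₁ a₁' a₂ a₂'} → ReplC b b' a₁ a₁' → ReplC b b' a₂ a₂' → ReplC b b' (a₁ ∧C a₂) (a₁' ∧C a₂')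
    _⊃C_ : ∀ {a₁ a₁' a₂ a₂'} → ReplC b b' a₁ a₁' → ReplC b b' a₂ a₂' → ReplC b b' (a₁ ⊃C a₂) (a₁' ⊃C a₂')
    cf : ∀ {X a a'} → ReplC b b' a a' → ReplC b b' (X □→C a) (X □→C a')

  data ReplIn (θ θ' : PCO) (a : CO) : CO → Set where
    same : ReplIn θ θ' a a
    co : ∀ {a'} (b b' : CO) → θ ≡ ↑ b → θ' ≡ ↑ b' → ReplC b b' a a' → ReplIn θ θ' a a'

  data Repl (θ θ' : PCO) : PCO → PCO → Set where
    here : Repl θ θ' θ θ'
    same : ∀ {φ} → Repl θ θ' φ φ
    pr : ∀ {c a a' e} → ReplIn θ θ' a a' → Repl θ θ' (pr c a e) (pr c a' e)
    prp : ∀ {c a a' b b'} → ReplIn θ θ' a a' → ReplIn θ θ' b b' → Repl θ θ' (prp c a b) (prp c a' b')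
    _∧P_ : ∀ {φ₁ φ₁' φ₂ φ₂'} → Repl θ θ' φ₁ φ₁' → Repl θ θ' φ₂ φ₂' → Repl θ θ' (φ₁ ∧P φ₂) (φ₁' ∧P φ₂')
    _⊔_ : ∀ {φ₁ φ₁' φ₂ φ₂'} → Repl θ θ' φ₁ φ₁' → Repl θ θ' φ₂ φ₂' → Repl θ θ' (φ₁ ⊔ φ₂) (φ₁' ⊔ φ₂')
    _⊃P_ : ∀ {a a' φ φ'} → ReplIn θ θ' a a' → Repl θ θ' φ φ' → Repl θ θ' (a ⊃P φ) (a' ⊃P φ')
    cf : ∀ {X φ φ'} → Repl θ θ' φ φ' → Repl θ θ' (X □→P φ) (X □→P φ')

  -- Derivability.  Γ ⊢ φ : φ is derivable from the set Γ (a predicate on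
  -- PCO).  Rules Rep, Mon⊃, Mon□→, →to⊃ only apply to theorems (∅ ⊢ _).
  -- Infinitary rules have one premise per rational ε.

  ∅ : PCO → Set
  ∅ _ = ⊥

  infix 2 _⊢_
  data _⊢_ : (PCO → Set) → PCO → Set₁ where
    ax  : ∀ {Γ φ} → Ax φ → Γ ⊢ φ
    hyp : ∀ {Γ φ} → Γ φ → Γ ⊢ φ
    MP  : ∀ {Γ ψ χ} → Γ ⊢ ψ → Γ ⊢ (ψ ⇒ χ) → Γ ⊢ χ
    Rep : ∀ {Γ φ φ' θ θ'} → ∅ ⊢ φ → ∅ ⊢ (θ ⇔ θ') → Repl θ θ' φ φ' → Γ ⊢ φ'
    ⊥ω  : ∀ {Γ ψ a} → ((ε : Prob) → Γ ⊢ (ψ ⇒ PrNe a ε)) → Γ ⊢ (ψ ⇒ ⊥P)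
    Mon⊃ : ∀ {Γ ψ χ} a → ∅ ⊢ (ψ ⇒ χ) → Γ ⊢ ((a ⊃P ψ) ⇒ (a ⊃P χ))
    →to⊃ : ∀ {Γ a ψ} → ∅ ⊢ (↑ a ⇒ ψ) → Γ ⊢ (a ⊃P ψ)
    ⊃ω : ∀ {Γ ψ a b} (δ : Prob) →
         ((ε γ : Prob) → 0ℚ < val ε → val γ ≡ val δ * val ε →
            Γ ⊢ (ψ ⇒ (PrEq (a ∧C b) γ ⇔ PrEq a ε))) →
         Γ ⊢ (ψ ⇒ (a ⊃P PrEq b δ))
    Mon□→ : ∀ {Γ ψ χ} (X : Asg) → ∅ ⊢ (ψ ⇒ χ) → Γ ⊢ ((X □→P ψ) ⇒ (X □→P χ))

-- The calculus satisfies the deduction theorem: the rules Rep, Mon⊃, Mon□→ and →to⊃ apply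
-- only to theorems, so they never touch a hypothesis φ, and the infinitary rules ⊥ω
-- and ⊃ω have premises ψ ⇒ … whose antecedent can absorb φ as a conjunct. Hence α ⊢ η
-- yields ⊢ α ⇒ η, and →to⊃ turns this into ⊢ α ⊃ η. When η is a CO formula β, the theorem
-- α ⊃ β has probability 1 by P1, and P6b gives Pr(α) = ε → Pr(β) ≥ ε.
module Submission where

open import Defs
open import Data.Bool using (true; false)
open import Data.Nat using (ℕ; zero; suc)
open import Data.Product using (_×_; _,_)
open import Data.Sum using (_⊎_; inj₁; inj₂)
open import Relation.Binary.PropositionalEquality using (_≡_; refl)

module _ {σ : Sig} where

  private variable
    Γ Δ : PCO {σ} → Set
    φ ψ χ η : PCO {σ}
    α : CO {σ}

  private
    [_,_,_] : PCO {σ} → PCO {σ} → PCO {σ} → ℕ → PCO {σ}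
    [ φ , ψ , χ ] zero = φ
    [ φ , ψ , χ ] (suc zero) = ψ
    [ φ , ψ , χ ] (suc (suc _)) = χ

    P Q R : PF {σ}
    P = pv 0
    Q = pv 1
    R = pv 2

  ⇒-refl : Γ ⊢ φ ⇒ φ
  ⇒-refl {φ = φ} = ax (T1 (p→ P P) [ φ , φ , φ ] valid)
    where
    valid : ∀ v → evalPF v (p→ P P) ≡ true
    valid v with v 0
    ... | true = refl
    ... | false = refl

  ⇒-const : Γ ⊢ φ ⇒ (ψ ⇒ φ)
  ⇒-const {φ = φ} {ψ = ψ} = ax (T1 (p→ P (p→ Q P)) [ φ , ψ , φ ] valid)
    where
    valid : ∀ v → evalPF v (p→ P (p→ Q P)) ≡ true
    valid v with v 0 | v 1
    ... | true | true = refl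
    ... | true | false = refl
    ... | false | _ = refl

  ⇒-weaken : Γ ⊢ ψ → Γ ⊢ φ ⇒ ψ
  ⇒-weaken {ψ = ψ} {φ = φ} d = MP d (⇒-const {φ = ψ} {ψ = φ})

  ⇒-mp : Γ ⊢ φ ⇒ ψ → Γ ⊢ φ ⇒ (ψ ⇒ χ) → Γ ⊢ φ ⇒ χ
  ⇒-mp {φ = φ} {ψ = ψ} {χ = χ} d e =
    MP e (MP d (ax (T1 (p→ (p→ P Q) (p→ (p→ P (p→ Q R)) (p→ P R))) [ φ , ψ , χ ] valid)))
    where
    valid : ∀ v → evalPF v (p→ (p→ P Q) (p→ (p→ P (p→ Q R)) (p→ P R))) ≡ true
    valid v with v 0 | v 1 | v 2
    ... | true | true | true = refl
    ... | true | true | false = refl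
    ... | true | false | _ = refl
    ... | false | _ | _ = refl

  ⇒-curry : Γ ⊢ (φ ∧P ψ) ⇒ χ → Γ ⊢ φ ⇒ (ψ ⇒ χ)
  ⇒-curry {φ = φ} {ψ = ψ} {χ = χ} d =
    MP d (ax (T1 (p→ (p→ (p∧ P Q) R) (p→ P (p→ Q R))) [ φ , ψ , χ ] valid))
    where
    valid : ∀ v → evalPF v (p→ (p→ (p∧ P Q) R) (p→ P (p→ Q R))) ≡ true
    valid v with v 0 | v 1 | v 2
    ... | true | true | true = refl
    ... | true | true | false = refl
    ... | true | false | _ = refl
    ... | false | _ | _ = refl

  ⇒-uncurry : Γ ⊢ φ ⇒ (ψ ⇒ χ) → Γ ⊢ (φ ∧P ψ) ⇒ χ
  ⇒-uncurry {φ = φ} {ψ = ψ} {χ = χ} d =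
    MP d (ax (T1 (p→ (p→ P (p→ Q R)) (p→ (p∧ P Q) R)) [ φ , ψ , χ ] valid))
    where
    valid : ∀ v → evalPF v (p→ (p→ P (p→ Q R)) (p→ (p∧ P Q) R)) ≡ true
    valid v with v 0 | v 1 | v 2
    ... | true | true | true = refl
    ... | true | true | false = refl
    ... | true | false | _ = refl
    ... | false | _ | _ = refl

  ⇔-to : Γ ⊢ φ ⇔ ψ → Γ ⊢ φ ⇒ ψ
  ⇔-to {φ = φ} {ψ = ψ} d = MP d (ax (T1 (p→ (p∧ P Q) P) [ φ ⇒ ψ , ψ ⇒ φ , ψ ] valid))
    where
    valid : ∀ v → evalPF v (p→ (p∧ P Q) P) ≡ true
    valid v with v 0 | v 1
    ... | true | true = refl
    ... | true | false = refl
    ... | false | _ = refl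

  -- ᶜ is not injective, so the antecedent of ⇒ can never be inferred and is passed explicitly.
  module _ (φ : PCO {σ}) (Δ⊆Γ,φ : ∀ {ψ} → Δ ψ → Γ ψ ⊎ ψ ≡ φ) where

    deduction : Δ ⊢ η → Γ ⊢ φ ⇒ η
    deduction (ax a) = ⇒-weaken {φ = φ} (ax a)
    deduction (hyp h) with Δ⊆Γ,φ h
    ... | inj₁ h' = ⇒-weaken {φ = φ} (hyp h')
    ... | inj₂ refl = ⇒-refl
    deduction (MP d e) = ⇒-mp {φ = φ} (deduction d) (deduction e)
    deduction (Rep d e r) = ⇒-weaken {φ = φ} (Rep d e r)
    deduction (⊥ω {ψ = ψ} {a = a} d) =
      ⇒-curry {φ = φ} {ψ = ψ} (⊥ω {ψ = φ ∧P ψ} {a = a} λ ε →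
        ⇒-uncurry {φ = φ} {ψ = ψ} (deduction (d ε)))
    deduction (Mon⊃ {ψ = ψ} {χ = χ} a d) = ⇒-weaken {φ = φ} (Mon⊃ {ψ = ψ} {χ = χ} a d)
    deduction (→to⊃ d) = ⇒-weaken {φ = φ} (→to⊃ d)
    deduction (⊃ω {ψ = ψ} {a = a} {b = b} δ d) =
      ⇒-curry {φ = φ} {ψ = ψ} (⊃ω {ψ = φ ∧P ψ} {a = a} {b = b} δ λ ε γ ε>0 γ≡δε →
        ⇒-uncurry {φ = φ} {ψ = ψ} (deduction (d ε γ ε>0 γ≡δε)))
    deduction (Mon□→ {ψ = ψ} {χ = χ} X d) = ⇒-weaken {φ = φ} (Mon□→ {ψ = ψ} {χ = χ} X d)

  Pr≡1-intro : Γ ⊢ ↑ α → Γ ⊢ PrEq α oneP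
  Pr≡1-intro {α = α} d = MP d (⇔-to (ax (P1 α)))

mainTheorem4 : (σ : Sig) →
    ((α : CO {σ}) (η : PCO {σ}) → ((_≡ ↑ α) ⊢ η) → (∅ ⊢ (α ⊃P η)))
    × ((α β : CO {σ}) → ((_≡ ↑ α) ⊢ ↑ β) → (ε : Prob) → ∅ ⊢ (PrEq α ε ⇒ PrGe β ε))
mainTheorem4 σ = ⊃-intro , Pr-mono
  where
  ⊃-intro : (α : CO {σ}) (η : PCO {σ}) → (_≡ ↑ α) ⊢ η → ∅ ⊢ α ⊃P η
  ⊃-intro α η d = →to⊃ (deduction (↑ α) inj₂ d)

  Pr-mono : (α β : CO {σ}) → (_≡ ↑ α) ⊢ ↑ β → (ε : Prob) → ∅ ⊢ PrEq α ε ⇒ PrGe β ε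
  -- ↑ (α ⊃C β) is definitionally α ⊃P ↑ β.
  Pr-mono α β d ε = MP (Pr≡1-intro {α = α ⊃C β} (⊃-intro α (↑ β) d)) (ax (P6b α β ε))
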